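{- Let $H$ be a linear hypergraph and $\mathscr{N}$ a finite set of subhypergraphs of $H$ partitioned as $\mathscr{N}=\mathscr{A}\,\dot\cup\,\mathscr{B}$ such that $|V(\mathscr{A})\cap V(\mathscr{B})|\le1$. If both $\mathscr{A}$ and $\mathscr{B}$ are forests of copies, then so is $\mathscr{N}$.
   Context: Hypergraphs are pairs $(V,E)$ with $E$ a set of $k$-subsets of a finite set $V$; linear means two distinct edges share at most one vertex. For a set $\mathscr{M}$ of subhypergraphs, $V(\mathscr{M})=\bigcup_{F\in\mathscr{M}}V(F)$ and $E(\mathscr{M})=\bigcup_{F\in\mathscr{M}}E(F)$. An enumeration $(F_1,\dots,F_{|\mathscr{M}|})$ of $\mathscr{M}$ is admissible if for every $j\in[2,|\mathscr{M}|]$ the set $z_j=V(F_j)\cap\bigcup_{i<j}V(F_i)$ either is an edge in $E(F_j)\cap\bigcup_{i<j}E(F_i)$ or has at most one element; $\mathscr{M}$ is a forest of copies if it has an admissible enumeration. -}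

module Defs where

open import Data.Nat using (ℕ; _≤_)
open import Data.Fin using (Fin)
open import Data.Fin.Subset using (Subset; _∈_; _∉_; _∪_; _∩_; _⊆_; ∣_∣; ⊥)
open import Data.Vec using (Vec; lookup)
open import Data.List using (List; []; _∷_; foldr)
open import Data.List.Relation.Binary.Permutation.Propositional using (_↭_)
open import Data.Product using (Σ; ∃; _×_; proj₁; proj₂)
open import Data.Sum using (_⊎_)
open import Data.Unit using (⊤)
open import Relation.Binary.PropositionalEquality using (_≡_; _≢_)

-- A k-uniform hypergraph on the vertex set Fin n with m distinct edges,
-- the edges being enumerated by Fin m (so E(H) = {edge i | i : Fin m}).
record Hypergraph (k : ℕ) : Set where
  field
    n        : ℕ
    m        : ℕ
    edge     : Vec (Subset n) m
    uniform  : ∀ i → ∣ lookup edge i ∣ ≡ k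
    distinct : ∀ i j → lookup edge i ≡ lookup edge j → i ≡ j
open Hypergraph public

Linear : ∀ {k} → Hypergraph k → Set
Linear H = ∀ i j → i ≢ j → ∣ lookup (edge H) i ∩ lookup (edge H) j ∣ ≤ 1

-- A candidate subhypergraph of H: a vertex subset and a subset of E(H)
-- (given by edge indices).  Two such are equal iff they are the same
-- subhypergraph.
Sub : ∀ {k} → Hypergraph k → Set
Sub H = Subset (n H) × Subset (m H)

V : ∀ {k} {H : Hypergraph k} → Sub H → Subset (n H)
V = proj₁

E : ∀ {k} {H : Hypergraph k} → Sub H → Subset (m H)
E = proj₂

IsSub : ∀ {k} (H : Hypergraph k) → Sub H → Set
IsSub H F = ∀ i → i ∈ E {H = H} F → lookup (edge H) i ⊆ V {H = H} F

Vs : ∀ {k} {H : Hypergraph k} → List (Sub H) → Subset (n H)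
Vs {H = H} = foldr (λ F U → V {H = H} F ∪ U) ⊥

Es : ∀ {k} {H : Hypergraph k} → List (Sub H) → Subset (m H)
Es {H = H} = foldr (λ F U → E {H = H} F ∪ U) ⊥

-- condition on F_j given VU = ⋃_{i<j} V(F_i), EU = ⋃_{i<j} E(F_i):
-- z_j = V(F_j) ∩ VU is an edge in E(F_j) ∩ EU, or |z_j| ≤ 1
AdmStep : ∀ {k} (H : Hypergraph k) → Subset (n H) → Subset (m H) → Sub H → Set
AdmStep H VU EU F =
  (Σ (Fin (m H)) λ i → i ∈ E {H = H} F × i ∈ EU
      × lookup (edge H) i ≡ (V {H = H} F ∩ VU))
  ⊎ ∣ V {H = H} F ∩ VU ∣ ≤ 1

AdmFrom : ∀ {k} (H : Hypergraph k) → Subset (n H) → Subset (m H) → List (Sub H) → Set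
AdmFrom H VU EU [] = ⊤
AdmFrom H VU EU (F ∷ L) =
  AdmStep H VU EU F × AdmFrom H (VU ∪ V {H = H} F) (EU ∪ E {H = H} F) L

Admissible : ∀ {k} (H : Hypergraph k) → List (Sub H) → Set
Admissible H [] = ⊤
Admissible H (F ∷ L) = AdmFrom H (V {H = H} F) (E {H = H} F) L

-- a finite set 𝓜 (given as a duplicate-free list) is a forest of copies
-- if some enumeration of it (a permutation of the list) is admissible
ForestOfCopies : ∀ {k} (H : Hypergraph k) → List (Sub H) → Set
ForestOfCopies H M = ∃ λ L → L ↭ M × Admissible H L

{-# OPTIONS --safe #-}
-- An admissible enumeration can be restarted at any of its copies G.  If P
-- precedes G, the attachment set of G to P (an edge, or at most one vertex)
-- lies in a single copy F of P, and F attaches to G in that same set; so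
-- enumerate G, then P restarted at F (recursively, P being shorter), then the
-- copies after G.  Now enumerate 𝓐, then 𝓑 restarted at a copy G containing
-- V(𝓐) ∩ V(𝓑): G meets V(𝓐) in at most one vertex, and every later copy of 𝓑
-- meets V(𝓐) only inside G.
module Submission where

open import Defs
open import Data.Nat using (ℕ; _≤_; _<_; z≤n; z<s)
open import Data.Nat.Induction using (<-wellFounded)
open import Data.Nat.Properties using (<-irrefl; ≤-trans; m<m+n; module ≤-Reasoning)
open import Data.Fin using () renaming (_≟_ to _≟ᶠ_)
open import Data.Fin.Subset using (Subset; _∩_; _∪_; _⊆_; ∣_∣; ⊥; _-_; ⁅_⁆)
  renaming (_∈_ to _∈ˢ_)
open import Data.Fin.Subset.Properties
open import Data.List using (List; []; _∷_; _++_; length; foldr)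
open import Data.List.Properties using (length-++; ++-identityʳ)
open import Data.List.Membership.Propositional using (_∈_; _∉_)
open import Data.List.Membership.Propositional.Properties using (∈-∃++)
open import Data.List.Relation.Unary.All as All using (All; []; _∷_)
import Data.List.Relation.Unary.All.Properties as All
open import Data.List.Relation.Unary.Any using (here; there)
open import Data.List.Relation.Unary.Unique.Propositional using (Unique)
open import Data.List.Relation.Binary.Permutation.Propositional
  using (_↭_; refl; prep; swap; trans; ↭-sym)
open import Data.List.Relation.Binary.Permutation.Propositional.Properties
  using (All-resp-↭; ∈-resp-↭; shift; ++⁺; ++⁺ʳ)
open import Data.Product using (∃; _×_; _,_)
open import Data.Sum using (inj₁; inj₂)
open import Data.Unit using (tt)
open import Function using (_∘′_)
open import Induction.WellFounded using (Acc; acc)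
open import Relation.Nullary using (yes; no)
open import Relation.Nullary.Negation using (contradiction)
open import Relation.Binary.PropositionalEquality
  using (_≡_; refl; sym; cong; cong₂; subst; subst₂; module ≡-Reasoning)
  renaming (trans to ≡-trans)

module _ {n : ℕ} where

  ∣p∣≤1⇒x≡y : ∀ {p : Subset n} {x y} → ∣ p ∣ ≤ 1 → x ∈ˢ p → y ∈ˢ p → x ≡ y
  ∣p∣≤1⇒x≡y {p} {x} {y} ∣p∣≤1 x∈p y∈p with x ≟ᶠ y
  ... | yes x≡y = x≡y
  ... | no x≢y = contradiction 1<1 (<-irrefl refl)
    where
      ⁅y⁆⊆p-x : ⁅ y ⁆ ⊆ p - x
      ⁅y⁆⊆p-x w∈⁅y⁆ rewrite x∈⁅y⁆⇒x≡y y w∈⁅y⁆ = x∈p∧x≢y⇒x∈p-y y∈p (λ y≡x → x≢y (sym y≡x))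
      open ≤-Reasoning
      1<1 : 1 < 1
      1<1 = begin-strict
        1          ≡⟨ ∣⁅x⁆∣≡1 y ⟨
        ∣ ⁅ y ⁆ ∣  ≤⟨ p⊆q⇒∣p∣≤∣q∣ ⁅y⁆⊆p-x ⟩
        ∣ p - x ∣  <⟨ x∈p⇒∣p-x∣<∣p∣ x∈p ⟩
        ∣ p ∣      ≤⟨ ∣p∣≤1 ⟩
        1          ∎

  ∣p∣≤1∧x∈p⇒p⊆ : ∀ {p q : Subset n} {x} → ∣ p ∣ ≤ 1 → x ∈ˢ p → x ∈ˢ q → p ⊆ q
  ∣p∣≤1∧x∈p⇒p⊆ ∣p∣≤1 x∈p x∈q y∈p = subst (_∈ˢ _) (∣p∣≤1⇒x≡y ∣p∣≤1 x∈p y∈p) x∈q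

  ∪-monoˡ-⊆ : ∀ {p p′ : Subset n} q → p ⊆ p′ → p ∪ q ⊆ p′ ∪ q
  ∪-monoˡ-⊆ {p} q p⊆p′ x∈p∪q with x∈p∪q⁻ p q x∈p∪q
  ... | inj₁ x∈p = p⊆p∪q q (p⊆p′ x∈p)
  ... | inj₂ x∈q = q⊆p∪q _ q x∈q

⋃[_] : ∀ {A : Set} {n} → (A → Subset n) → List A → Subset n
⋃[ f ] = foldr (λ F U → f F ∪ U) ⊥

module _ {A : Set} {n : ℕ} (f : A → Subset n) where

  ∈⇒⊆⋃ : ∀ {F L} → F ∈ L → f F ⊆ ⋃[ f ] L
  ∈⇒⊆⋃ {L = G ∷ L} (here refl) = p⊆p∪q (⋃[ f ] L)
  ∈⇒⊆⋃ {L = G ∷ L} (there F∈L) = q⊆p∪q (f G) _ ∘′ ∈⇒⊆⋃ F∈L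

  ∈-⋃⁻ : ∀ {x} L → x ∈ˢ ⋃[ f ] L → ∃ λ F → F ∈ L × x ∈ˢ f F
  ∈-⋃⁻ [] x∈⊥ = contradiction x∈⊥ ∉⊥
  ∈-⋃⁻ (G ∷ L) x∈⋃ with x∈p∪q⁻ (f G) (⋃[ f ] L) x∈⋃
  ... | inj₁ x∈G = G , here refl , x∈G
  ... | inj₂ x∈⋃L with ∈-⋃⁻ L x∈⋃L
  ...   | F , F∈L , x∈F = F , there F∈L , x∈F

  ⋃-↭ : ∀ {L M} → L ↭ M → ⋃[ f ] L ≡ ⋃[ f ] M
  ⋃-↭ refl = refl
  ⋃-↭ (prep F L↭M) = cong (f F ∪_) (⋃-↭ L↭M)
  ⋃-↭ (swap {xs} {ys} F G L↭M) = begin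
    f F ∪ (f G ∪ ⋃[ f ] xs)  ≡⟨ ∪-assoc (f F) (f G) _ ⟨
    (f F ∪ f G) ∪ ⋃[ f ] xs  ≡⟨ cong (_∪ ⋃[ f ] xs) (∪-comm (f F) (f G)) ⟩
    (f G ∪ f F) ∪ ⋃[ f ] xs  ≡⟨ ∪-assoc (f G) (f F) _ ⟩
    f G ∪ (f F ∪ ⋃[ f ] xs)  ≡⟨ cong (λ U → f G ∪ (f F ∪ U)) (⋃-↭ L↭M) ⟩
    f G ∪ (f F ∪ ⋃[ f ] ys)  ∎
    where open ≡-Reasoning
  ⋃-↭ (trans L↭M M↭N) = ≡-trans (⋃-↭ L↭M) (⋃-↭ M↭N)

  ⊆⋃⇒⊆-member : ∀ {p x} L → ∣ p ∣ ≤ 1 → x ∈ˢ p → p ⊆ ⋃[ f ] L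
    → ∃ λ F → F ∈ L × p ⊆ f F
  ⊆⋃⇒⊆-member L ∣p∣≤1 x∈p p⊆⋃ with ∈-⋃⁻ L (p⊆⋃ x∈p)
  ... | F , F∈L , x∈F = F , F∈L , ∣p∣≤1∧x∈p⇒p⊆ ∣p∣≤1 x∈p x∈F

  ⊆⋃∷⇒⊆-member : ∀ {p} G L → ∣ p ∣ ≤ 1 → p ⊆ ⋃[ f ] (G ∷ L)
    → ∃ λ F → F ∈ G ∷ L × p ⊆ f F
  ⊆⋃∷⇒⊆-member {p} G L ∣p∣≤1 p⊆⋃ with nonempty? p
  ... | yes (x , x∈p) = ⊆⋃⇒⊆-member (G ∷ L) ∣p∣≤1 x∈p p⊆⋃
  ... | no p-empty = G , here refl , λ x∈p → contradiction (_ , x∈p) p-empty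

length-<-++∷ : ∀ {A : Set} (P Q : List A) (G : A) → length P < length (P ++ G ∷ Q)
length-<-++∷ P Q G = subst (length P <_) (sym (length-++ P)) (m<m+n (length P) z<s)

module _ {k : ℕ} (H : Hypergraph k) where

  private
    Vₕ : Sub H → Subset (n H)
    Vₕ = V {H = H}
    Eₕ : Sub H → Subset (m H)
    Eₕ = E {H = H}

  AdmStep-resp : ∀ {U U′ D D′} F → AdmStep H U D F
    → Vₕ F ∩ U′ ≡ Vₕ F ∩ U → D ⊆ D′ → AdmStep H U′ D′ F
  AdmStep-resp F (inj₁ (i , i∈F , i∈D , edge≡z)) z′≡z D⊆D′ =
    inj₁ (i , i∈F , D⊆D′ i∈D , ≡-trans edge≡z (sym z′≡z))
  AdmStep-resp F (inj₂ ∣z∣≤1) z′≡z _ = inj₂ (subst (λ z → ∣ z ∣ ≤ 1) (sym z′≡z) ∣z∣≤1)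

  AdmFrom-enlarge : ∀ {U U′ D D′} L → U ⊆ U′ → D ⊆ D′
    → All (λ F → Vₕ F ∩ U′ ⊆ U) L → AdmFrom H U D L → AdmFrom H U′ D′ L
  AdmFrom-enlarge [] _ _ _ _ = tt
  AdmFrom-enlarge {U} {U′} (F ∷ L) U⊆U′ D⊆D′ (F∩U′⊆U ∷ meets) (step , rest) =
    AdmStep-resp F step z′≡z D⊆D′ ,
    AdmFrom-enlarge L (∪-monoˡ-⊆ (Vₕ F) U⊆U′) (∪-monoˡ-⊆ (Eₕ F) D⊆D′)
      (All.map (λ {G} → extend {G}) meets) rest
    where
      z′≡z : Vₕ F ∩ U′ ≡ Vₕ F ∩ U
      z′≡z = ⊆-antisym (λ x∈ → x∈p∩q⁺ (p∩q⊆p _ _ x∈ , F∩U′⊆U x∈))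
                       (λ x∈ → let x∈F , x∈U = x∈p∩q⁻ _ _ x∈ in x∈p∩q⁺ (x∈F , U⊆U′ x∈U))
      extend : ∀ {G} → Vₕ G ∩ U′ ⊆ U → Vₕ G ∩ (U′ ∪ Vₕ F) ⊆ U ∪ Vₕ F
      extend G∩U′⊆U x∈ with x∈p∩q⁻ _ _ x∈
      ... | x∈G , x∈U′∪F with x∈p∪q⁻ U′ _ x∈U′∪F
      ...   | inj₁ x∈U′ = p⊆p∪q _ (G∩U′⊆U (x∈p∩q⁺ (x∈G , x∈U′)))
      ...   | inj₂ x∈F = q⊆p∪q U _ x∈F

  AdmFrom-++⁻ : ∀ {U D} L M → AdmFrom H U D (L ++ M)
    → AdmFrom H U D L × AdmFrom H (U ∪ ⋃[ Vₕ ] L) (D ∪ ⋃[ Eₕ ] L) M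
  AdmFrom-++⁻ {U} {D} [] M adm =
    tt , subst₂ (λ U D → AdmFrom H U D M) (sym (∪-identityʳ U)) (sym (∪-identityʳ D)) adm
  AdmFrom-++⁻ {U} {D} (F ∷ L) M (step , rest) with AdmFrom-++⁻ L M rest
  ... | admL , admM = (step , admL) ,
    subst₂ (λ U D → AdmFrom H U D M) (∪-assoc U (Vₕ F) _) (∪-assoc D (Eₕ F) _) admM

  AdmFrom-++⁺ : ∀ {U D} L M → AdmFrom H U D L
    → AdmFrom H (U ∪ ⋃[ Vₕ ] L) (D ∪ ⋃[ Eₕ ] L) M → AdmFrom H U D (L ++ M)
  AdmFrom-++⁺ {U} {D} [] M _ admM =
    subst₂ (λ U D → AdmFrom H U D M) (∪-identityʳ U) (∪-identityʳ D) admM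
  AdmFrom-++⁺ {U} {D} (F ∷ L) M (step , admL) admM =
    step , AdmFrom-++⁺ L M admL
      (subst₂ (λ U D → AdmFrom H U D M)
        (sym (∪-assoc U (Vₕ F) _)) (sym (∪-assoc D (Eₕ F) _)) admM)

  Admissible⇒AdmFrom⊥ : ∀ L → Admissible H L → AdmFrom H ⊥ ⊥ L
  Admissible⇒AdmFrom⊥ [] _ = tt
  Admissible⇒AdmFrom⊥ (F ∷ L) adm =
    inj₂ (subst (λ z → ∣ z ∣ ≤ 1) (sym (∩-zeroʳ (Vₕ F)))
           (subst (_≤ 1) (sym (∣⊥∣≡0 (n H))) z≤n)) ,
    subst₂ (λ U D → AdmFrom H U D L) (sym (∪-identityˡ (Vₕ F))) (sym (∪-identityˡ (Eₕ F))) adm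

  AdmFrom⊥⇒Admissible : ∀ L → AdmFrom H ⊥ ⊥ L → Admissible H L
  AdmFrom⊥⇒Admissible [] _ = tt
  AdmFrom⊥⇒Admissible (F ∷ L) (_ , adm) =
    subst₂ (λ U D → AdmFrom H U D L) (∪-identityˡ (Vₕ F)) (∪-identityˡ (Eₕ F)) adm

  attachment≡ : ∀ {G F P} → F ∈ P → Vₕ G ∩ ⋃[ Vₕ ] P ⊆ Vₕ F
    → Vₕ F ∩ Vₕ G ≡ Vₕ G ∩ ⋃[ Vₕ ] P
  attachment≡ F∈P z⊆F = ⊆-antisym
    (λ x∈ → let x∈F , x∈G = x∈p∩q⁻ _ _ x∈ in x∈p∩q⁺ (x∈G , ∈⇒⊆⋃ Vₕ F∈P x∈F))
    (λ x∈ → x∈p∩q⁺ (z⊆F x∈ , p∩q⊆p _ _ x∈))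

  attaching-copy : ∀ {x} G P → All (IsSub H) P
    → AdmStep H (⋃[ Vₕ ] P) (⋃[ Eₕ ] P) G → x ∈ˢ Vₕ G ∩ ⋃[ Vₕ ] P
    → ∃ λ F → F ∈ P × Vₕ G ∩ ⋃[ Vₕ ] P ⊆ Vₕ F × AdmStep H (Vₕ G) (Eₕ G) F
  attaching-copy G P subs (inj₁ (i , i∈G , i∈P , edge≡z)) _ with ∈-⋃⁻ Eₕ P i∈P
  ... | F , F∈P , i∈F =
    F , F∈P , z⊆F , inj₁ (i , i∈F , i∈G , ≡-trans edge≡z (sym (attachment≡ {G} F∈P z⊆F)))
    where
      z⊆F : Vₕ G ∩ ⋃[ Vₕ ] P ⊆ Vₕ F
      z⊆F x∈z = All.lookup subs F∈P i i∈F (subst (_ ∈ˢ_) (sym edge≡z) x∈z)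
  attaching-copy G P subs (inj₂ ∣z∣≤1) x∈z with ⊆⋃⇒⊆-member Vₕ P ∣z∣≤1 x∈z (p∩q⊆q _ _)
  ... | F , F∈P , z⊆F =
    F , F∈P , z⊆F , inj₂ (subst (λ z → ∣ z ∣ ≤ 1) (sym (attachment≡ {G} F∈P z⊆F)) ∣z∣≤1)

  reroot-last : ∀ P G → Acc _<_ (length P) → All (IsSub H) P → AdmFrom H ⊥ ⊥ P
    → AdmStep H (⋃[ Vₕ ] P) (⋃[ Eₕ ] P) G → ∃ λ R → R ↭ P × Admissible H (G ∷ R)
  reroot-member : ∀ L G → Acc _<_ (length L) → G ∈ L → All (IsSub H) L → AdmFrom H ⊥ ⊥ L
    → ∃ λ R → G ∷ R ↭ L × Admissible H (G ∷ R)

  reroot-last P G rec subs adm step with nonempty? (Vₕ G ∩ ⋃[ Vₕ ] P)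
  ... | no disjoint = P , refl , AdmFrom-enlarge P ⊥⊆ ⊥⊆ (All.tabulate meets-nothing) adm
    where
      meets-nothing : ∀ {F} → F ∈ P → Vₕ F ∩ Vₕ G ⊆ ⊥
      meets-nothing F∈P x∈ = let x∈F , x∈G = x∈p∩q⁻ _ _ x∈ in
        contradiction (_ , x∈p∩q⁺ (x∈G , ∈⇒⊆⋃ Vₕ F∈P x∈F)) disjoint
  ... | yes (_ , x∈z) with attaching-copy G P subs step x∈z
  ... | F , F∈P , z⊆F , stepF with reroot-member P F rec F∈P subs adm
  ... | R , F∷R↭P , admF∷R =
    F ∷ R , F∷R↭P , stepF ,
    AdmFrom-enlarge R (q⊆p∪q (Vₕ G) _) (q⊆p∪q (Eₕ G) _) (All.tabulate meets-only-F) admF∷R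
    where
      meets-only-F : ∀ {F′} → F′ ∈ R → Vₕ F′ ∩ (Vₕ G ∪ Vₕ F) ⊆ Vₕ F
      meets-only-F F′∈R x∈ with x∈p∩q⁻ _ _ x∈
      ... | x∈F′ , x∈G∪F with x∈p∪q⁻ (Vₕ G) _ x∈G∪F
      ...   | inj₁ x∈G = z⊆F (x∈p∩q⁺ (x∈G , ∈⇒⊆⋃ Vₕ (∈-resp-↭ F∷R↭P (there F′∈R)) x∈F′))
      ...   | inj₂ x∈F = x∈F

  reroot-member L G (acc rs) G∈L subs adm with ∈-∃++ G∈L
  ... | P , Q , refl with AdmFrom-++⁻ P (G ∷ Q) adm
  ... | admP , stepG , admQ
    with reroot-last P G (rs (length-<-++∷ P Q G)) (All.++⁻ˡ P subs) admP
           (subst₂ (λ U D → AdmStep H U D G) (∪-identityˡ _) (∪-identityˡ _) stepG)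
  ... | R , R↭P , admG∷R =
    R ++ Q , trans (prep G (++⁺ʳ Q R↭P)) (↭-sym (shift G P Q)) ,
    AdmFrom-++⁺ R Q admG∷R (subst₂ (λ U D → AdmFrom H U D Q) (reorder Vₕ) (reorder Eₕ) admQ)
    where
      reorder : ∀ {t} (f : Sub H → Subset t) → (⊥ ∪ ⋃[ f ] P) ∪ f G ≡ f G ∪ ⋃[ f ] R
      reorder f = begin
        (⊥ ∪ ⋃[ f ] P) ∪ f G  ≡⟨ cong (_∪ f G) (∪-identityˡ _) ⟩
        ⋃[ f ] P ∪ f G        ≡⟨ ∪-comm _ _ ⟩
        f G ∪ ⋃[ f ] P        ≡⟨ cong (f G ∪_) (⋃-↭ f R↭P) ⟨
        f G ∪ ⋃[ f ] R        ∎
        where open ≡-Reasoning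

  reroot : ∀ L G → G ∈ L → All (IsSub H) L → Admissible H L
    → ∃ λ R → G ∷ R ↭ L × Admissible H (G ∷ R)
  reroot L G G∈L subs adm =
    reroot-member L G (<-wellFounded (length L)) G∈L subs (Admissible⇒AdmFrom⊥ L adm)

  Admissible-++∷ : ∀ L G R → Admissible H L → Admissible H (G ∷ R)
    → ∣ ⋃[ Vₕ ] L ∩ ⋃[ Vₕ ] (G ∷ R) ∣ ≤ 1 → ⋃[ Vₕ ] L ∩ ⋃[ Vₕ ] (G ∷ R) ⊆ Vₕ G
    → Admissible H (L ++ G ∷ R)
  Admissible-++∷ L G R admL admG∷R ∣I∣≤1 I⊆G =
    AdmFrom⊥⇒Admissible (L ++ G ∷ R) (AdmFrom-++⁺ L (G ∷ R) (Admissible⇒AdmFrom⊥ L admL)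
      ( inj₂ (≤-trans (p⊆q⇒∣p∣≤∣q∣ G∩L⊆I) ∣I∣≤1)
      , AdmFrom-enlarge R (q⊆p∪q _ (Vₕ G)) (q⊆p∪q _ (Eₕ G)) (All.tabulate meets-only-G) admG∷R))
    where
      in-⋃L : ∀ {x} → x ∈ˢ ⊥ ∪ ⋃[ Vₕ ] L → x ∈ˢ ⋃[ Vₕ ] L
      in-⋃L = subst (_ ∈ˢ_) (∪-identityˡ _)
      G∩L⊆I : Vₕ G ∩ (⊥ ∪ ⋃[ Vₕ ] L) ⊆ ⋃[ Vₕ ] L ∩ ⋃[ Vₕ ] (G ∷ R)
      G∩L⊆I x∈ = let x∈G , x∈L = x∈p∩q⁻ _ _ x∈ in
        x∈p∩q⁺ (in-⋃L x∈L , p⊆p∪q _ x∈G)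
      meets-only-G : ∀ {F} → F ∈ R → Vₕ F ∩ ((⊥ ∪ ⋃[ Vₕ ] L) ∪ Vₕ G) ⊆ Vₕ G
      meets-only-G F∈R x∈ with x∈p∩q⁻ _ _ x∈
      ... | x∈F , x∈L∪G with x∈p∪q⁻ (⊥ ∪ ⋃[ Vₕ ] L) _ x∈L∪G
      ...   | inj₁ x∈L = I⊆G (x∈p∩q⁺ (in-⋃L x∈L , ∈⇒⊆⋃ Vₕ {L = G ∷ R} (there F∈R) x∈F))
      ...   | inj₂ x∈G = x∈G

lemma13p5 : ∀ {k} (H : Hypergraph k) → Linear H
    → (𝓐 𝓑 : List (Sub H))
    → All (IsSub H) 𝓐 → All (IsSub H) 𝓑
    → Unique 𝓐 → Unique 𝓑 → (∀ F → F ∈ 𝓐 → F ∉ 𝓑)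
    → ∣ Vs {H = H} 𝓐 ∩ Vs {H = H} 𝓑 ∣ ≤ 1
    → ForestOfCopies H 𝓐 → ForestOfCopies H 𝓑
    → ForestOfCopies H (𝓐 ++ 𝓑)
lemma13p5 H _ 𝓐 𝓑 _ _ _ _ _ _ (L𝓐 , L𝓐↭𝓐 , adm𝓐) ([] , []↭𝓑 , _) =
  L𝓐 ++ [] , ++⁺ L𝓐↭𝓐 []↭𝓑 , subst (Admissible H) (sym (++-identityʳ L𝓐)) adm𝓐
lemma13p5 H _ 𝓐 𝓑 _ subs𝓑 _ _ _ ∣I∣≤1 (L𝓐 , L𝓐↭𝓐 , adm𝓐) (B ∷ L𝓑 , L𝓑↭𝓑 , adm𝓑)
  with ⊆⋃∷⇒⊆-member (V {H = H}) B L𝓑 ∣I∣≤1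
         (subst (_ ∈ˢ_) (sym (⋃-↭ (V {H = H}) L𝓑↭𝓑)) ∘′ p∩q⊆q _ _)
... | G , G∈L𝓑 , I⊆G
  with reroot H (B ∷ L𝓑) G G∈L𝓑 (All-resp-↭ (↭-sym L𝓑↭𝓑) subs𝓑) adm𝓑
... | R , G∷R↭L𝓑 , admG∷R =
  L𝓐 ++ G ∷ R , ++⁺ L𝓐↭𝓐 G∷R↭𝓑 ,
  Admissible-++∷ H L𝓐 G R adm𝓐 admG∷R
    (subst (λ I → ∣ I ∣ ≤ 1) (sym I≡) ∣I∣≤1) (subst (_⊆ Vᴴ G) (sym I≡) I⊆G)
  where
    Vᴴ : Sub H → Subset (n H)
    Vᴴ = V {H = H}
    G∷R↭𝓑 : G ∷ R ↭ 𝓑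
    G∷R↭𝓑 = trans G∷R↭L𝓑 L𝓑↭𝓑
    I≡ : ⋃[ Vᴴ ] L𝓐 ∩ ⋃[ Vᴴ ] (G ∷ R) ≡ ⋃[ Vᴴ ] 𝓐 ∩ ⋃[ Vᴴ ] 𝓑
    I≡ = cong₂ _∩_ (⋃-↭ Vᴴ L𝓐↭𝓐) (⋃-↭ Vᴴ G∷R↭𝓑)
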